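{- Let $T=(\alpha_1,\dots,\alpha_{k+1})$ be the semitrace of an operation array $M=(\mu_1,\dots,\mu_k)$ of length $n+1$, and let $a,b$ be distinct elements of $[n]$. Then the segment $T_{a,b}$ is forbidden if and only if $(a,b)$ is a violating pair of $T$.
   Context: An operation sequence of length $n+1$ is a word $c_1\dots c_{n+1}$ over $\{\mathtt{a},\mathtt{d}\}$ with $c_1=c_{n+1}=\mathtt{a}$; the letter $c_m$ sits between positions $m-1$ and $m$ of a permutation of $[n]$, and $c_m=\mathtt{a}$ is called a bar. For a permutation $\pi$ of $[n]$ and operation sequence $\mu$ with $\mathtt{a}$'s at indices $i_1<\dots<i_t$, the blocks of $\pi$ w.r.t. $\mu$ are the factors at positions $i_j,\dots,i_{j+1}-1$, and $\mathrm{rev}(\pi,\mu)$ reverses each block. An operation array of order $k$ is a $k$-tuple $M=(\mu_1,\dots,\mu_k)$ of operation sequences of length $n+1$; its semitrace is $(\alpha_1,\dots,\alpha_{k+1})$ with $\alpha_{k+1}$ the identity and $\alpha_i=\mathrm{rev}(\alpha_{i+1},\mu_i)$. For $i\in[k]$, say $a,b$ violate row $i$ if they occupy adjacent positions $m,m+1$ of $\alpha_i$ (in either order) and either $\alpha_i(m)>\alpha_i(m+1)$ and the $(m+1)$-st letter of $\mu_i$ is $\mathtt{a}$, or $\alpha_i(m)<\alpha_i(m+1)$ and that letter is $\mathtt{d}$. $(a,b)$ is a violating pair of $T$ if $a,b$ violate some row $i\in[k]$. A segment of $M$ is the array of columns $i,\dots,j$ of $M$ ($1\le i\le j\le n+1$),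 column $m$ being the $m$-th letters of $\mu_1,\dots,\mu_k$. $T_{a,b}$ is the smallest segment containing all blocks of $\alpha_r$ w.r.t. $\mu_r$, $r=2,\dots,k$, that contain $a$ or $b$ (a block occupying positions $p..q$ is contained in columns $i..j$ if $i\le p$, $q+1\le j$). $T_{a,b}$ is forbidden if (F0) $a,b$ violate row $i$ for some $2\le i\le k$; or (F1) $a,b$ occupy adjacent positions $m,m+1$ of $\alpha_2$ with $\alpha_2(m)>\alpha_2(m+1)$ and the $(m+1)$-st letter of $\mu_1$ is $\mathtt{d}$; or (F2) in $\alpha_2$ the larger of $a,b$ is at position $p$ and the smaller at position $q$ with $p<q$, the $p$-th and $(q+1)$-st letters of $\mu_1$ are $\mathtt{a}$, and exactly one of the letters of $\mu_1$ at indices $p+1,\dots,q$ is $\mathtt{a}$. -}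

module Defs where

open import Data.Nat using (ℕ; zero; suc; _+_; _∸_; _≤_; _<_; _⊔_; _⊓_)
open import Data.Product using (Σ; ∃; _×_; _,_)
open import Data.Sum using (_⊎_)
open import Relation.Binary.PropositionalEquality using (_≡_)

-- Conventions: everything is 1-indexed exactly as in the paper.
-- A word c₁…c_{n+1} is a function ℕ → Op; only indices 1..n+1 are ever read.
-- A permutation (or arrangement) π of [n] is a function ℕ → ℕ; π m is the
-- entry at position m (1 ≤ m ≤ n); only positions 1..n are ever read.

data Op : Set where
  𝕒 𝕕 : Op

Word : Set
Word = ℕ → Op

IsOpSeq : ℕ → Word → Set
IsOpSeq n c = c 1 ≡ 𝕒 × c (suc n) ≡ 𝕒

blockStart : Word → ℕ → ℕ
blockStart c zero = zero
blockStart c (suc m) with c (suc m)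
... | 𝕒 = suc m
... | 𝕕 = blockStart c m

nextBar : Word → ℕ → ℕ → ℕ
nextBar c m zero = suc m
nextBar c m (suc fuel) with c (suc m)
... | 𝕒 = suc m
... | 𝕕 = nextBar c (suc m) fuel

blockEnd : ℕ → Word → ℕ → ℕ
blockEnd n c m = nextBar c m n ∸ 1

rev : ℕ → (ℕ → ℕ) → Word → (ℕ → ℕ)
rev n π μ m = π ((blockStart μ m + blockEnd n μ m) ∸ m)

IsOpArray : ℕ → ℕ → (ℕ → Word) → Set
IsOpArray n k M = ∀ i → 1 ≤ i → i ≤ k → IsOpSeq n (M i)

-- semitrace: α_{k+1} = id, α_i = rev(α_{i+1}, μ_i)
-- semiAux t = α_{k+1-t}
semiAux : ℕ → (ℕ → Word) → ℕ → ℕ → (ℕ → ℕ)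
semiAux n M k zero m = m
semiAux n M k (suc t) = rev n (semiAux n M k t) (M (k ∸ t))

semitrace : ℕ → (ℕ → Word) → ℕ → ℕ → (ℕ → ℕ)
semitrace n M k i = semiAux n M k (suc k ∸ i)

AdjAt : (ℕ → ℕ) → ℕ → ℕ → ℕ → Set
AdjAt α m a b = (α m ≡ a × α (suc m) ≡ b) ⊎ (α m ≡ b × α (suc m) ≡ a)

Violates : ℕ → (ℕ → Word) → ℕ → ℕ → ℕ → ℕ → Set
Violates n M k i a b =
  let α = semitrace n M k i in
  ∃ λ m → 1 ≤ m × suc m ≤ n × AdjAt α m a b ×
    ((α (suc m) < α m × M i (suc m) ≡ 𝕒) ⊎ (α m < α (suc m) × M i (suc m) ≡ 𝕕))

ViolatingPair : ℕ → (ℕ → Word) → ℕ → ℕ → ℕ → Set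
ViolatingPair n M k a b = ∃ λ i → 1 ≤ i × i ≤ k × Violates n M k i a b

F0 : ℕ → (ℕ → Word) → ℕ → ℕ → ℕ → Set
F0 n M k a b = ∃ λ i → 2 ≤ i × i ≤ k × Violates n M k i a b

F1 : ℕ → (ℕ → Word) → ℕ → ℕ → ℕ → Set
F1 n M k a b =
  let α₂ = semitrace n M k 2 in
  ∃ λ m → 1 ≤ m × suc m ≤ n × AdjAt α₂ m a b ×
    α₂ (suc m) < α₂ m × M 1 (suc m) ≡ 𝕕

F2 : ℕ → (ℕ → Word) → ℕ → ℕ → ℕ → Set
F2 n M k a b =
  let α₂ = semitrace n M k 2 in
  ∃ λ p → ∃ λ q → 1 ≤ p × p < q × q ≤ n ×
    α₂ p ≡ a ⊔ b × α₂ q ≡ a ⊓ b ×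
    M 1 p ≡ 𝕒 × M 1 (suc q) ≡ 𝕒 ×
    (∃ λ j → p < j × j ≤ q × M 1 j ≡ 𝕒 ×
       (∀ j′ → p < j′ → j′ ≤ q → M 1 j′ ≡ 𝕒 → j′ ≡ j))

Forbidden : ℕ → (ℕ → Word) → ℕ → ℕ → ℕ → Set
Forbidden n M k a b = F0 n M k a b ⊎ F1 n M k a b ⊎ F2 n M k a b

-- Rows 2, …, k contribute the same violations to both sides, so everything happens in
-- row 1, where α₁ = rev(α₂, μ₁). Reversal reflects each block [s, e] of μ₁ by y ↦ s + e − y.
-- A violation of row 1 at a 𝕕 (an ascent of α₁ inside a block) is therefore the reflected
-- image of a descent of α₂ inside that block, which is (F1). A violation at a bar m + 1 (a
-- descent of α₁ across the bar) pairs the first entry of the block ending at m with the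
-- last entry of the block starting at m + 1; in α₂ these are the larger and smaller element
-- sitting at the outer ends of two consecutive blocks, which is (F2).
module Submission where

open import Defs
open import Data.Nat using (ℕ; zero; suc; _+_; _∸_; _≤_; _<_; _⊔_; _⊓_; z≤n; s≤s; _≤?_)
open import Data.Nat.Properties
open import Data.Nat.Tactic.RingSolver using (solve)
open import Data.List using (_∷_; [])
open import Data.Product using (∃; ∃-syntax; _×_; _,_; proj₁; proj₂)
open import Data.Sum using (_⊎_; inj₁; inj₂)
open import Relation.Nullary using (yes; no; contradiction)
open import Relation.Binary.PropositionalEquality
open import Relation.Binary.Definitions using (tri<; tri≈; tri>)
open import Function.Bundles using (_⇔_; mk⇔; Equivalence)

𝕒≢𝕕 : 𝕒 ≢ 𝕕
𝕒≢𝕕 ()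

≢𝕒⇒≡𝕕 : ∀ {o} → o ≢ 𝕒 → o ≡ 𝕕
≢𝕒⇒≡𝕕 {𝕒} o≢𝕒 = contradiction refl o≢𝕒
≢𝕒⇒≡𝕕 {𝕕} _   = refl

BarFree : Word → ℕ → ℕ → Set
BarFree μ i j = ∀ x → i < x → x ≤ j → μ x ≡ 𝕕

module _ {μ : Word} where

  BarFree-empty : ∀ {i} → BarFree μ i i
  BarFree-empty x i<x x≤i = contradiction x≤i (<⇒≱ i<x)

  BarFree-extend : ∀ {i j} → BarFree μ i j → μ (suc j) ≡ 𝕕 → BarFree μ i (suc j)
  BarFree-extend free μ[1+j] x i<x x≤1+j with m≤n⇒m<n∨m≡n x≤1+j
  ... | inj₁ x≤j  = free x i<x (≤-pred x≤j)
  ... | inj₂ refl = μ[1+j]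

  BarFree-join : ∀ {i m j} → BarFree μ i m → BarFree μ m j → BarFree μ i j
  BarFree-join {m = m} left right x i<x x≤j with x ≤? m
  ... | yes x≤m = left x i<x x≤m
  ... | no  x≰m = right x (≰⇒> x≰m) x≤j

  bar-free-around⇒unique-bar : ∀ {p m q} → BarFree μ p m → BarFree μ (suc m) q →
    ∀ j → p < j → j ≤ q → μ j ≡ 𝕒 → j ≡ suc m
  bar-free-around⇒unique-bar {m = m} left right j p<j j≤q μj with <-cmp j (suc m)
  ... | tri< j<1+m _ _ = contradiction (trans (sym μj) (left j p<j (≤-pred j<1+m))) 𝕒≢𝕕
  ... | tri≈ _ j≡1+m _ = j≡1+m
  ... | tri> _ _ 1+m<j = contradiction (trans (sym μj) (right j 1+m<j j≤q)) 𝕒≢𝕕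

  unique-bar⇒bar-free-before : ∀ {p m q} → (∀ j → p < j → j ≤ q → μ j ≡ 𝕒 → j ≡ suc m) →
    suc m ≤ q → BarFree μ p m
  unique-bar⇒bar-free-before {m = m} unique 1+m≤q x p<x x≤m = ≢𝕒⇒≡𝕕 λ μx →
    1+n≰n (subst (_≤ m) (unique x p<x (≤-trans (m≤n⇒m≤1+n x≤m) 1+m≤q) μx) x≤m)

  unique-bar⇒bar-free-after : ∀ {p m q} → (∀ j → p < j → j ≤ q → μ j ≡ 𝕒 → j ≡ suc m) →
    p < suc m → BarFree μ (suc m) q
  unique-bar⇒bar-free-after unique p<1+m x 1+m<x x≤q = ≢𝕒⇒≡𝕕 λ μx →
    <-irrefl (sym (unique x (<-trans p<1+m 1+m<x) x≤q μx)) 1+m<x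

  last-bar-unique : ∀ {x x′ m} → x ≤ m → x′ ≤ m → μ x ≡ 𝕒 → μ x′ ≡ 𝕒 →
                    BarFree μ x m → BarFree μ x′ m → x ≡ x′
  last-bar-unique {x} {x′} x≤m x′≤m μx μx′ free free′ with <-cmp x x′
  ... | tri< x<x′ _ _ = contradiction (trans (sym μx′) (free x′ x<x′ x′≤m)) 𝕒≢𝕕
  ... | tri≈ _ x≡x′ _ = x≡x′
  ... | tri> _ _ x′<x = contradiction (trans (sym μx) (free′ x x′<x x≤m)) 𝕒≢𝕕

  first-bar-unique : ∀ {m e e′} → m ≤ e → m ≤ e′ → μ (suc e) ≡ 𝕒 → μ (suc e′) ≡ 𝕒 →
                     BarFree μ m e → BarFree μ m e′ → e ≡ e′
  first-bar-unique {m} {e} {e′} m≤e m≤e′ μe μe′ free free′ with <-cmp e e′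
  ... | tri< e<e′ _ _ = contradiction (trans (sym μe) (free′ (suc e) (s≤s m≤e) e<e′)) 𝕒≢𝕕
  ... | tri≈ _ e≡e′ _ = e≡e′
  ... | tri> _ _ e′<e = contradiction (trans (sym μe′) (free (suc e′) (s≤s m≤e′) e′<e)) 𝕒≢𝕕

  blockStart-spec : μ 1 ≡ 𝕒 → ∀ m → 1 ≤ m →
    let s = blockStart μ m in 1 ≤ s × s ≤ m × μ s ≡ 𝕒 × BarFree μ s m
  blockStart-spec μ₁ (suc m) _ with μ (suc m) in μ[1+m]
  ... | 𝕒 = s≤s z≤n , ≤-refl , μ[1+m] , BarFree-empty
  blockStart-spec μ₁ (suc zero) _ | 𝕕 = contradiction (trans (sym μ₁) μ[1+m]) 𝕒≢𝕕
  blockStart-spec μ₁ (suc (suc m)) _ | 𝕕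
    with blockStart-spec μ₁ (suc m) (s≤s z≤n)
  ... | 1≤s , s≤m , μs , free = 1≤s , m≤n⇒m≤1+n s≤m , μs , BarFree-extend free μ[1+m]

  nextBar-spec : ∀ f m {y} → m < y → y ≤ m + f → μ y ≡ 𝕒 →
    let N = nextBar μ m f in m < N × N ≤ y × μ N ≡ 𝕒 × (∀ x → m < x → x < N → μ x ≡ 𝕕)
  nextBar-spec zero m {y} m<y y≤m+0 _ = contradiction (subst (y ≤_) (+-identityʳ m) y≤m+0) (<⇒≱ m<y)
  nextBar-spec (suc f) m {y} m<y y≤m+f μy with μ (suc m) in μ[1+m]
  ... | 𝕒 = ≤-refl , m<y , μ[1+m] , λ x m<x x<1+m → contradiction (≤-pred x<1+m) (<⇒≱ m<x)
  ... | 𝕕 with m≤n⇒m<n∨m≡n m<y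
  ... | inj₂ refl = contradiction (trans (sym μy) μ[1+m]) 𝕒≢𝕕
  ... | inj₁ 1+m<y with nextBar-spec f (suc m) 1+m<y (subst (y ≤_) (+-suc m f) y≤m+f) μy
  ... | 1+m<N , N≤y , μN , free = <-trans (n<1+n m) 1+m<N , N≤y , μN , free′
    where
    free′ : ∀ x → m < x → x < nextBar μ (suc m) f → μ x ≡ 𝕕
    free′ x m<x x<N with m≤n⇒m<n∨m≡n m<x
    ... | inj₁ 1+m<x = free x 1+m<x x<N
    ... | inj₂ refl  = μ[1+m]

  -- The search for the next bar has fuel n, which reaches the bar at n + 1 because m ≥ 1.
  blockEnd-spec : ∀ {n m} → μ (suc n) ≡ 𝕒 → 1 ≤ m → m ≤ n →
    let e = blockEnd n μ m in m ≤ e × e ≤ n × μ (suc e) ≡ 𝕒 × BarFree μ m e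
  blockEnd-spec {n} {m} μ[1+n] 1≤m m≤n =
    predecessor (nextBar-spec n m (s≤s m≤n) (+-monoˡ-≤ n 1≤m) μ[1+n])
    where
    predecessor : ∀ {N} → m < N × N ≤ suc n × μ N ≡ 𝕒 × (∀ x → m < x → x < N → μ x ≡ 𝕕) →
      m ≤ N ∸ 1 × N ∸ 1 ≤ n × μ (suc (N ∸ 1)) ≡ 𝕒 × BarFree μ m (N ∸ 1)
    predecessor {suc e} (m<N , N≤1+n , μN , free) =
      ≤-pred m<N , ≤-pred N≤1+n , μN , λ x m<x x≤e → free x m<x (s≤s x≤e)

record Block (n : ℕ) (μ : Word) (s e : ℕ) : Set where
  field
    1≤start    : 1 ≤ s
    start≤end  : s ≤ e
    end≤n      : e ≤ n
    bar-start  : μ s ≡ 𝕒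
    bar-after  : μ (suc e) ≡ 𝕒
    free       : BarFree μ s e

module _ {n : ℕ} {μ : Word} (opSeq : IsOpSeq n μ) where
  private
    μ₁ = proj₁ opSeq
    μ[1+n] = proj₂ opSeq

  block-containing : ∀ {m} → 1 ≤ m → m ≤ n →
    Block n μ (blockStart μ m) (blockEnd n μ m) × blockStart μ m ≤ m × m ≤ blockEnd n μ m
  block-containing {m} 1≤m m≤n with blockStart-spec μ₁ m 1≤m | blockEnd-spec μ[1+n] 1≤m m≤n
  ... | 1≤s , s≤m , μs , free-s | m≤e , e≤n , μe , free-e =
    record { 1≤start = 1≤s ; start≤end = ≤-trans s≤m m≤e ; end≤n = e≤n
           ; bar-start = μs ; bar-after = μe ; free = BarFree-join free-s free-e }
    , s≤m , m≤e

  block-ending-at : ∀ {m} → 1 ≤ m → m ≤ n → μ (suc m) ≡ 𝕒 → Block n μ (blockStart μ m) m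
  block-ending-at {m} 1≤m m≤n μ[1+m] with blockStart-spec μ₁ m 1≤m
  ... | 1≤s , s≤m , μs , free =
    record { 1≤start = 1≤s ; start≤end = s≤m ; end≤n = m≤n
           ; bar-start = μs ; bar-after = μ[1+m] ; free = free }

  block-starting-at : ∀ {j} → 1 ≤ j → j ≤ n → μ j ≡ 𝕒 → Block n μ j (blockEnd n μ j)
  block-starting-at {j} 1≤j j≤n μj with blockEnd-spec μ[1+n] 1≤j j≤n
  ... | j≤e , e≤n , μe , free =
    record { 1≤start = 1≤j ; start≤end = j≤e ; end≤n = e≤n
           ; bar-start = μj ; bar-after = μe ; free = free }

  block-bounds : ∀ {s e y} → Block n μ s e → s ≤ y → y ≤ e →
                 blockStart μ y ≡ s × blockEnd n μ y ≡ e
  block-bounds {s} {e} {y} B s≤y y≤e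
    with blockStart-spec μ₁ y (≤-trans 1≤start s≤y)
       | blockEnd-spec μ[1+n] (≤-trans 1≤start s≤y) (≤-trans y≤e end≤n)
    where open Block B
  ... | _ , s′≤y , μs′ , free-s′ | y≤e′ , _ , μe′ , free-e′ =
    last-bar-unique s′≤y s≤y μs′ bar-start free-s′ (λ x s<x x≤y → free x s<x (≤-trans x≤y y≤e)) ,
    first-bar-unique y≤e′ y≤e μe′ bar-after free-e′ (λ x y<x x≤e → free x (≤-<-trans s≤y y<x) x≤e)
    where open Block B

  𝕕-after⇒<end : ∀ {s e y} → Block n μ s e → y ≤ e → μ (suc y) ≡ 𝕕 → y < e
  𝕕-after⇒<end B y≤e μ[1+y] =
    ≤∧≢⇒< y≤e λ { refl → 𝕒≢𝕕 (trans (sym (Block.bar-after B)) μ[1+y]) }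

  rev-block : ∀ (π : ℕ → ℕ) {s e y} → Block n μ s e → s ≤ y → y ≤ e →
              rev n π μ y ≡ π (s + e ∸ y)
  rev-block π {y = y} B s≤y y≤e =
    cong π (cong₂ (λ s e → s + e ∸ y) (proj₁ bounds) (proj₂ bounds))
    where bounds = block-bounds B s≤y y≤e

  rev-block-end : ∀ (π : ℕ → ℕ) {s e} → Block n μ s e → rev n π μ e ≡ π s
  rev-block-end π {s} {e} B =
    trans (rev-block π B (Block.start≤end B) ≤-refl) (cong π (m+n∸n≡m s e))

  rev-block-start : ∀ (π : ℕ → ℕ) {s e} → Block n μ s e → rev n π μ s ≡ π e
  rev-block-start π {s} {e} B =
    trans (rev-block π B ≤-refl (Block.start≤end B)) (cong π (m+n∸m≡n s e))

∸-from-+ : ∀ {x y z} → x ≡ y + z → x ∸ z ≡ y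
∸-from-+ {y = y} {z} refl = m+n∸n≡m y z

-- Under y ↦ s + e ∸ y, the reflection rev performs on a block [s, e], the adjacent pair m, m + 1
-- and the adjacent pair z, z + 1 are exchanged.
reflect-adjacent : ∀ {s m e} → s ≤ m → suc m ≤ e →
  ∃[ z ] s ≤ z × suc z ≤ e ×
    s + e ∸ m ≡ suc z × s + e ∸ suc m ≡ z × s + e ∸ z ≡ suc m × s + e ∸ suc z ≡ m
reflect-adjacent {s} s≤m m<e with m≤n⇒∃[o]m+o≡n s≤m
... | u , refl with m≤n⇒∃[o]m+o≡n m<e
... | t , refl =
  s + t , m≤m+n s t , s≤s (+-monoˡ-≤ t (m≤m+n s u)) ,
  ∸-from-+ split₁ , ∸-from-+ split₂ , ∸-from-+ split₃ , ∸-from-+ split₄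
  where
  split₁ : s + (suc (s + u) + t) ≡ suc (s + t) + (s + u)
  split₁ = solve (s ∷ u ∷ t ∷ [])
  split₂ : s + (suc (s + u) + t) ≡ (s + t) + suc (s + u)
  split₂ = solve (s ∷ u ∷ t ∷ [])
  split₃ : s + (suc (s + u) + t) ≡ suc (s + u) + (s + t)
  split₃ = solve (s ∷ u ∷ t ∷ [])
  split₄ : s + (suc (s + u) + t) ≡ (s + u) + suc (s + t)
  split₄ = solve (s ∷ u ∷ t ∷ [])

module _ (α : ℕ → ℕ) {m a b : ℕ} where

  AdjAt-reflect : ∀ β {z} → β (suc z) ≡ α m → β z ≡ α (suc m) → AdjAt α m a b → AdjAt β z a b
  AdjAt-reflect β p q (inj₁ (αm≡a , α[1+m]≡b)) = inj₂ (trans q α[1+m]≡b , trans p αm≡a)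
  AdjAt-reflect β p q (inj₂ (αm≡b , α[1+m]≡a)) = inj₁ (trans q α[1+m]≡a , trans p αm≡b)

  AdjAt-descent⇒⊔-⊓ : AdjAt α m a b → α (suc m) < α m → α m ≡ a ⊔ b × α (suc m) ≡ a ⊓ b
  AdjAt-descent⇒⊔-⊓ (inj₁ (refl , refl)) b<a = sym (m≥n⇒m⊔n≡m (<⇒≤ b<a)) , sym (m≥n⇒m⊓n≡n (<⇒≤ b<a))
  AdjAt-descent⇒⊔-⊓ (inj₂ (refl , refl)) a<b = sym (m≤n⇒m⊔n≡n (<⇒≤ a<b)) , sym (m≤n⇒m⊓n≡m (<⇒≤ a<b))

  ⊔-⊓⇒AdjAt-descent : a ≢ b → α m ≡ a ⊔ b → α (suc m) ≡ a ⊓ b → AdjAt α m a b × α (suc m) < α m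
  ⊔-⊓⇒AdjAt-descent a≢b αm≡a⊔b α[1+m]≡a⊓b with <-cmp a b
  ... | tri< a<b _ _ rewrite m≤n⇒m⊔n≡n (<⇒≤ a<b) | m≤n⇒m⊓n≡m (<⇒≤ a<b) =
    inj₂ (αm≡a⊔b , α[1+m]≡a⊓b) , subst₂ _<_ (sym α[1+m]≡a⊓b) (sym αm≡a⊔b) a<b
  ... | tri≈ _ a≡b _ = contradiction a≡b a≢b
  ... | tri> _ _ b<a rewrite m≥n⇒m⊔n≡m (<⇒≤ b<a) | m≥n⇒m⊓n≡n (<⇒≤ b<a) =
    inj₁ (αm≡a⊔b , α[1+m]≡a⊓b) , subst₂ _<_ (sym α[1+m]≡a⊓b) (sym αm≡a⊔b) b<a

ViolatesRow : ℕ → Word → (ℕ → ℕ) → ℕ → ℕ → Set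
ViolatesRow n μ α a b = ∃ λ m → 1 ≤ m × suc m ≤ n × AdjAt α m a b ×
  ((α (suc m) < α m × μ (suc m) ≡ 𝕒) ⊎ (α m < α (suc m) × μ (suc m) ≡ 𝕕))

DescentInsideBlock : ℕ → Word → (ℕ → ℕ) → ℕ → ℕ → Set
DescentInsideBlock n μ β a b = ∃ λ m → 1 ≤ m × suc m ≤ n × AdjAt β m a b ×
  β (suc m) < β m × μ (suc m) ≡ 𝕕

DescentAcrossBlocks : ℕ → Word → (ℕ → ℕ) → ℕ → ℕ → Set
DescentAcrossBlocks n μ β a b = ∃ λ p → ∃ λ q → 1 ≤ p × p < q × q ≤ n ×
  β p ≡ a ⊔ b × β q ≡ a ⊓ b × μ p ≡ 𝕒 × μ (suc q) ≡ 𝕒 ×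
  (∃ λ j → p < j × j ≤ q × μ j ≡ 𝕒 × (∀ j′ → p < j′ → j′ ≤ q → μ j′ ≡ 𝕒 → j′ ≡ j))

module _ {n : ℕ} {μ : Word} (opSeq : IsOpSeq n μ) {α β : ℕ → ℕ} (α≗rev : α ≗ rev n β μ) where

  reflected-pair : ∀ {m} → 1 ≤ m → suc m ≤ n → μ (suc m) ≡ 𝕕 →
    ∃[ z ] 1 ≤ z × suc z ≤ n × μ (suc z) ≡ 𝕕 ×
      (β (suc z) ≡ α m × β z ≡ α (suc m)) × (α (suc z) ≡ β m × α z ≡ β (suc m))
  reflected-pair {m} 1≤m 1+m≤n μ[1+m] with block-containing opSeq 1≤m (≤-trans (n≤1+n m) 1+m≤n)
  ... | B , s≤m , m≤e with 𝕕-after⇒<end opSeq B m≤e μ[1+m]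
  ... | m<e with reflect-adjacent s≤m m<e
  ... | z , s≤z , z<e , S∸m , S∸1+m , S∸z , S∸1+z =
    z , ≤-trans 1≤start s≤z , ≤-trans z<e end≤n , free (suc z) (s≤s s≤z) z<e ,
    (sym (trans (α-at s≤m (<⇒≤ m<e)) (cong β S∸m)) , sym (trans (α-at (m≤n⇒m≤1+n s≤m) m<e) (cong β S∸1+m))) ,
    (trans (α-at (m≤n⇒m≤1+n s≤z) z<e) (cong β S∸1+z) , trans (α-at s≤z (<⇒≤ z<e)) (cong β S∸z))
    where
    open Block B
    α-at : ∀ {y} → blockStart μ m ≤ y → y ≤ blockEnd n μ m → α y ≡ β (blockStart μ m + blockEnd n μ m ∸ y)
    α-at s≤y y≤e = trans (α≗rev _) (rev-block opSeq β B s≤y y≤e)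

  reversed-across-bar : ∀ {p m q} → Block n μ p m → Block n μ (suc m) q → α m ≡ β p × α (suc m) ≡ β q
  reversed-across-bar B₁ B₂ =
    trans (α≗rev _) (rev-block-end opSeq β B₁) , trans (α≗rev _) (rev-block-start opSeq β B₂)

  module _ {a b : ℕ} (a≢b : a ≢ b) where

    across-bar⇒descent : ∀ {p m q} → Block n μ p m → Block n μ (suc m) q →
      AdjAt α m a b → α (suc m) < α m → DescentAcrossBlocks n μ β a b
    across-bar⇒descent {m = m} B₁ B₂ adj descent
      with AdjAt-descent⇒⊔-⊓ α adj descent | reversed-across-bar B₁ B₂
    ... | αm≡a⊔b , α[1+m]≡a⊓b | αm≡βp , α[1+m]≡βq =
      _ , _ , Block.1≤start B₁ , ≤-trans (s≤s (Block.start≤end B₁)) (Block.start≤end B₂) , Block.end≤n B₂ ,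
      trans (sym αm≡βp) αm≡a⊔b , trans (sym α[1+m]≡βq) α[1+m]≡a⊓b ,
      Block.bar-start B₁ , Block.bar-after B₂ ,
      suc m , s≤s (Block.start≤end B₁) , Block.start≤end B₂ , Block.bar-after B₁ ,
      bar-free-around⇒unique-bar (Block.free B₁) (Block.free B₂)

    across-blocks⇒violation : DescentAcrossBlocks n μ β a b → ViolatesRow n μ α a b
    across-blocks⇒violation (_ , _ , _ , _ , _ , _ , _ , _ , _ , zero , () , _)
    across-blocks⇒violation (p , q , 1≤p , _ , q≤n , βp , βq , μp , μ[1+q] , suc m , p<1+m , 1+m≤q , μ[1+m] , unique)
      with reversed-across-bar B₁ B₂
      where
      B₁ : Block n μ p m
      B₁ = record { 1≤start = 1≤p ; start≤end = ≤-pred p<1+m ; end≤n = ≤-trans (≤-trans (n≤1+n m) 1+m≤q) q≤n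
                  ; bar-start = μp ; bar-after = μ[1+m] ; free = unique-bar⇒bar-free-before unique 1+m≤q }
      B₂ : Block n μ (suc m) q
      B₂ = record { 1≤start = s≤s z≤n ; start≤end = 1+m≤q ; end≤n = q≤n
                  ; bar-start = μ[1+m] ; bar-after = μ[1+q] ; free = unique-bar⇒bar-free-after unique p<1+m }
    ... | αm≡βp , α[1+m]≡βq with ⊔-⊓⇒AdjAt-descent α a≢b (trans αm≡βp βp) (trans α[1+m]≡βq βq)
    ... | adj , descent =
      m , ≤-trans 1≤p (≤-pred p<1+m) , ≤-trans 1+m≤q q≤n , adj , inj₁ (descent , μ[1+m])

    violation⇒descent : ViolatesRow n μ α a b → DescentInsideBlock n μ β a b ⊎ DescentAcrossBlocks n μ β a b
    violation⇒descent (m , 1≤m , 1+m≤n , adj , inj₁ (descent , μ[1+m])) =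
      inj₂ (across-bar⇒descent (block-ending-at opSeq 1≤m (≤-trans (n≤1+n m) 1+m≤n) μ[1+m])
                               (block-starting-at opSeq (s≤s z≤n) 1+m≤n μ[1+m]) adj descent)
    violation⇒descent (m , 1≤m , 1+m≤n , adj , inj₂ (ascent , μ[1+m]))
      with reflected-pair 1≤m 1+m≤n μ[1+m]
    ... | z , 1≤z , 1+z≤n , μ[1+z] , (β[1+z]≡αm , βz≡α[1+m]) , _ =
      inj₁ (z , 1≤z , 1+z≤n , AdjAt-reflect α β β[1+z]≡αm βz≡α[1+m] adj ,
            subst₂ _<_ (sym β[1+z]≡αm) (sym βz≡α[1+m]) ascent , μ[1+z])

    descent⇒violation : DescentInsideBlock n μ β a b ⊎ DescentAcrossBlocks n μ β a b → ViolatesRow n μ α a b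
    descent⇒violation (inj₂ across) = across-blocks⇒violation across
    descent⇒violation (inj₁ (z , 1≤z , 1+z≤n , adj , descent , μ[1+z]))
      with reflected-pair 1≤z 1+z≤n μ[1+z]
    ... | w , 1≤w , 1+w≤n , μ[1+w] , _ , (α[1+w]≡βz , αw≡β[1+z]) =
      w , 1≤w , 1+w≤n , AdjAt-reflect β α α[1+w]≡βz αw≡β[1+z] adj ,
      inj₂ (subst₂ _<_ (sym αw≡β[1+z]) (sym α[1+w]≡βz) descent , μ[1+w])

    reversed-violation⇔descent : ViolatesRow n μ α a b ⇔ (DescentInsideBlock n μ β a b ⊎ DescentAcrossBlocks n μ β a b)
    reversed-violation⇔descent = mk⇔ violation⇒descent descent⇒violation

semitrace-rev : ∀ n M {k i} → i ≤ k → semitrace n M k i ≗ rev n (semitrace n M k (suc i)) (M i)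
semitrace-rev n M {k} {i} i≤k y rewrite +-∸-assoc 1 i≤k | m∸[m∸n]≡n i≤k = refl

lemma3 : (n k : ℕ) (M : ℕ → Word) → 1 ≤ k → IsOpArray n k M →
    (a b : ℕ) → 1 ≤ a → a ≤ n → 1 ≤ b → b ≤ n → a ≢ b →
    Forbidden n M k a b ⇔ ViolatingPair n M k a b
lemma3 n k M 1≤k opArray a b _ _ _ _ a≢b = mk⇔ forbidden⇒violating violating⇒forbidden
  where
  row₁ = reversed-violation⇔descent (opArray 1 ≤-refl 1≤k) (semitrace-rev n M 1≤k) a≢b

  forbidden⇒violating : Forbidden n M k a b → ViolatingPair n M k a b
  forbidden⇒violating (inj₁ (i , 2≤i , i≤k , violation)) = i , <⇒≤ 2≤i , i≤k , violation
  forbidden⇒violating (inj₂ descent) = 1 , ≤-refl , 1≤k , Equivalence.from row₁ descent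

  violating⇒forbidden : ViolatingPair n M k a b → Forbidden n M k a b
  violating⇒forbidden (zero , () , _)
  violating⇒forbidden (suc zero , _ , _ , violation) = inj₂ (Equivalence.to row₁ violation)
  violating⇒forbidden (suc (suc i) , _ , i≤k , violation) = inj₁ (suc (suc i) , s≤s (s≤s z≤n) , i≤k , violation)
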